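{- For every constant integer $k\ge 3$ there is a choice of the parameter $\rho$ such that, for every $n$, there is a graph with $\Theta(n)$ vertices on which the approximation ratio of $k\rho$-DP is at least $n-1$, and the approximation ratio of $k\rho$-Greedy is $\Omega(n^2)$.
   Context: For a weighted undirected graph $G=(V,E)$: $d(u,v)$ is the minimum path weight; $\hat d(u,v)$ is the minimum number of edges over paths of weight $d(u,v)$ ($\infty$ if disconnected). $\bar r_k(u)=\min_{v:\ \hat d(u,v)>k} d(u,v)$; $r_\rho(u)$ is the distance to the $\rho$-th closest vertex; $v$ has a $(k,\rho)$-ball iff $r_\rho(v)<\bar r_k(v)$; a $(k,\rho)$-graph is one where every vertex has a $(k,\rho)$-ball. A shortcut between distinct $u,v$ with $d(u,v)<\infty$, $\hat d(u,v)>1$ is a new edge $\{u,v\}$ of weight $d(u,v)$. $k\rho$-MSP: find a minimum-cardinality shortcut set $S$ making $(V,E\cup S)$ a $(k,\rho)$-graph. The approximation ratio of a heuristic on an instance is the number of shortcuts it outputs divided by the optimum number. Heuristic $k\rho$-DP: for each source $s\in V$ independently, let $T_s$ be a shortest-path tree from $s$ to its $\rho$ nearest neighbours such that for each $v\in T_s$ the tree path from $s$ to $v$ has $\hat d(s,v)$ edges. For a node $u\ne s$ of $T_s$ whose parent is at (current) depth $t$, define $F(u,t)=\infty$ if $t\ge k$, and otherwise $F(u,t)=\min\big(1+\sum_{w \text{ child of } u}F(w,1),\ \sum_{w \text{ child of } u}F(w,t+1)\big)$, where the first option corresponds to adding the shortcut $\{s,u\}$. The shortcuts $S_s$ chosen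 for $s$ are those (all incident to $s$) realizing the minimum $\sum_{u \text{ child of } s}F(u,0)$; the output is $\bigcup_s S_s$. Heuristic $k\rho$-Greedy: for every vertex $u$, add a shortcut from $u$ to every vertex among its $\rho$ nearest neighbours whose hop distance from $u$ exceeds $k$. -}

module Defs where

open import Data.Nat using (ℕ; zero; suc; _+_; _≤_; _<_; _<ᵇ_; _≤ᵇ_)
open import Data.Bool using (Bool; true; false; _∧_; not; if_then_else_)
open import Data.Maybe using (Maybe; just; nothing)
open import Data.Fin using (Fin; toℕ; _≟_)
open import Data.Fin.Subset using (Subset; _∈_; _∉_; ∣_∣)
open import Data.List using (List; []; _∷_; filterᵇ; length; map; concatMap; allFin; foldr)
open import Data.Vec using (lookup)
open import Data.Product using (Σ; ∃; ∃-syntax; _×_; _,_; proj₁; proj₂)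
open import Data.Sum using (_⊎_)
open import Function.Bundles using (_⇔_)
open import Relation.Nullary using (¬_; does)
open import Relation.Binary.PropositionalEquality using (_≡_; _≢_)

-- Extended naturals (∞ = unreachable / infeasible)

data ℕ∞ : Set where
  fin : ℕ → ℕ∞
  ∞   : ℕ∞

data _≤∞_ : ℕ∞ → ℕ∞ → Set where
  fin≤fin : ∀ {m n} → m ≤ n → fin m ≤∞ fin n
  any≤∞   : ∀ {x} → x ≤∞ ∞

data _<∞_ : ℕ∞ → ℕ∞ → Set where
  fin<fin : ∀ {m n} → m < n → fin m <∞ fin n
  fin<∞   : ∀ {m} → fin m <∞ ∞

_+∞_ : ℕ∞ → ℕ∞ → ℕ∞
fin m +∞ fin n = fin (m + n)
fin m +∞ ∞     = ∞
∞     +∞ _     = ∞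

min∞ : ℕ∞ → ℕ∞ → ℕ∞
min∞ (fin m) (fin n) = if m ≤ᵇ n then fin m else fin n
min∞ (fin m) ∞       = fin m
min∞ ∞       y       = y

sum∞ : List ℕ∞ → ℕ∞
sum∞ = foldr _+∞_ (fin 0)

-- Weighted undirected (simple) graphs on vertex set Fin N with
-- positive integer edge weights.  w u v = nothing means "no edge".

record Graph : Set where
  field
    N     : ℕ
    w     : Fin N → Fin N → Maybe ℕ
    w-sym : ∀ u v → w u v ≡ w v u
    w-loop : ∀ u → w u u ≡ nothing
    w-pos : ∀ u v c → w u v ≡ just c → 1 ≤ c

-- A (multi)edge relation: E u v c  =  "there is an edge {u,v} of weight c"
EdgeRel : ℕ → Set₁
EdgeRel N = Fin N → Fin N → ℕ → Set

GEdge : (G : Graph) → EdgeRel (Graph.N G)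
GEdge G u v c = Graph.w G u v ≡ just c

data Walk {N : ℕ} (E : EdgeRel N) : Fin N → Fin N → ℕ → ℕ → Set where
  nil  : ∀ {u} → Walk E u u 0 0
  cons : ∀ {u x v c W h} → E u x c → Walk E x v W h → Walk E u v (c + W) (suc h)

Reachable : ∀ {N} → EdgeRel N → Fin N → Fin N → Set
Reachable E u v = ∃[ W ] ∃[ h ] Walk E u v W h

IsDist : ∀ {N} → EdgeRel N → Fin N → Fin N → ℕ∞ → Set
IsDist E u v (fin D) = (∃[ h ] Walk E u v D h) × (∀ W h → Walk E u v W h → D ≤ W)
IsDist E u v ∞       = ∀ W h → ¬ Walk E u v W h

IsHop : ∀ {N} → EdgeRel N → Fin N → Fin N → ℕ∞ → Set
IsHop E u v (fin h) =
  ∃[ D ] (IsDist E u v (fin D) × Walk E u v D h × (∀ h' → Walk E u v D h' → h ≤ h'))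
IsHop E u v ∞ = IsDist E u v ∞

IsMinOf : (ℕ∞ → Set) → ℕ∞ → Set
IsMinOf P m = (∀ x → P x → m ≤∞ x) × (P m ⊎ (m ≡ ∞ × (∀ x → ¬ P x)))

IsBarR : ∀ {N} → EdgeRel N → ℕ → Fin N → ℕ∞ → Set
IsBarR E k u =
  IsMinOf (λ x → ∃[ v ] ∃[ H ] (IsHop E u v H × fin k <∞ H × IsDist E u v x))

DistLt DistLe : ∀ {N} → EdgeRel N → Fin N → Fin N → ℕ∞ → Set
DistLt E u v r = ∃[ D ] (IsDist E u v D × D <∞ r)
DistLe E u v r = ∃[ D ] (IsDist E u v D × D ≤∞ r)

-- r_ρ(u) = distance from u to its ρ-th closest vertex (u itself, at
-- distance 0, counts as the closest); the ρ-th smallest element of the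
-- multiset { d(u,v) : v ∈ V }, and ∞ if fewer than ρ vertices are reachable.
IsRρ : ∀ {N} → EdgeRel N → ℕ → Fin N → ℕ∞ → Set
IsRρ {N} E ρ u r =
  (∀ (B : Subset N) → (∀ v → v ∈ B → DistLt E u v r) → ∣ B ∣ < ρ) ×
  (r ≡ ∞ ⊎ ∃[ A ] ((∀ v → v ∈ A → DistLe E u v r) × ρ ≤ ∣ A ∣))

HasBall : ∀ {N} → EdgeRel N → ℕ → ℕ → Fin N → Set
HasBall E k ρ v = ∃[ a ] ∃[ b ] (IsRρ E ρ v a × IsBarR E k v b × a <∞ b)

IsKRGraph : ∀ {N} → EdgeRel N → ℕ → ℕ → Set
IsKRGraph {N} E k ρ = ∀ (v : Fin N) → HasBall E k ρ v

-- Shortcut sets: sets of unordered pairs, as symmetric Boolean matrices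

ShortcutSet : ℕ → Set
ShortcutSet N = Fin N → Fin N → Bool

allPairs : ∀ N → List (Fin N × Fin N)
allPairs N = concatMap (λ u → map (λ v → (u , v)) (allFin N)) (allFin N)

card : ∀ {N} → ShortcutSet N → ℕ
card {N} S = length (filterᵇ (λ p → (toℕ (proj₁ p) <ᵇ toℕ (proj₂ p)) ∧ S (proj₁ p) (proj₂ p)) (allPairs N))

ValidShortcuts : (G : Graph) → ShortcutSet (Graph.N G) → Set
ValidShortcuts G S =
  (∀ u v → S u v ≡ S v u) ×
  (∀ u v → S u v ≡ true →
     (u ≢ v) × (∃[ D ] IsDist (GEdge G) u v (fin D)) ×
     (∃[ H ] (IsHop (GEdge G) u v H × fin 1 <∞ H)))

Augment : (G : Graph) → ShortcutSet (Graph.N G) → EdgeRel (Graph.N G)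
Augment G S u v c = GEdge G u v c ⊎ ((S u v ≡ true) × IsDist (GEdge G) u v (fin c))

IsOpt : (G : Graph) → ℕ → ℕ → ℕ → Set
IsOpt G k ρ m =
  (∃[ S ] (ValidShortcuts G S × IsKRGraph (Augment G S) k ρ × card S ≡ m)) ×
  (∀ S → ValidShortcuts G S → IsKRGraph (Augment G S) k ρ → m ≤ card S)

-- A is a set of ρ nearest neighbours of u (u itself included; ties broken
-- arbitrarily; only reachable vertices; fewer than ρ if fewer are reachable)

IsNearest : ∀ {N} → EdgeRel N → ℕ → Fin N → Subset N → Set
IsNearest E ρ u A =
  (∀ v → v ∈ A → Reachable E u v) ×
  (∣ A ∣ ≤ ρ) ×
  (∣ A ∣ ≡ ρ ⊎ (∀ v → Reachable E u v → v ∈ A)) ×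
  (∀ v x D D' → v ∈ A → x ∉ A → IsDist E u v D → IsDist E u x D' → D ≤∞ D')

-- kρ-Greedy: S is a possible output (for some choice of nearest-neighbour sets)

GreedyOutput : (G : Graph) → ℕ → ℕ → ShortcutSet (Graph.N G) → Set
GreedyOutput G k ρ S =
  ∃[ A ] ((∀ u → IsNearest (GEdge G) ρ u (A u)) ×
          (∀ u v → (S u v ≡ true) ⇔ (Pick A u v ⊎ Pick A v u)))
  where
  Pick : (Fin (Graph.N G) → Subset (Graph.N G)) → Fin (Graph.N G) → Fin (Graph.N G) → Set
  Pick A u v = (v ∈ A u) × ∃[ H ] (IsHop (GEdge G) u v H × fin k <∞ H)

-- T_s: shortest-path tree from s to a set A of its ρ nearest neighbours,
-- given by parent pointers, whose tree path to v has d̂(s,v) edges.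
record SPTree (G : Graph) (ρ : ℕ) (s : Fin (Graph.N G)) : Set where
  field
    A       : Subset (Graph.N G)
    nearest : IsNearest (GEdge G) ρ s A
    par     : Fin (Graph.N G) → Fin (Graph.N G)
    par-ok  : ∀ v → v ∈ A → v ≢ s →
                (par v ∈ A) × ∃[ c ] ∃[ D ] ∃[ h ]
                  (Graph.w G (par v) v ≡ just c ×
                   IsDist (GEdge G) s (par v) (fin D) × IsDist (GEdge G) s v (fin (D + c)) ×
                   IsHop (GEdge G) s (par v) (fin h) × IsHop (GEdge G) s v (fin (suc h)))

module DP (G : Graph) (k ρ : ℕ) {s : Fin (Graph.N G)} (T : SPTree G ρ s) where
  open SPTree T

  children : Fin (Graph.N G) → List (Fin (Graph.N G))
  children u = filterᵇ (λ x → lookup A x ∧ not (does (x ≟ s)) ∧ does (par x ≟ u)) (allFin (Graph.N G))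

  -- F(u,t), with structural fuel (fuel N is never exhausted on the tree)
  F : ℕ → Fin (Graph.N G) → ℕ → ℕ∞
  F zero    u t = ∞
  F (suc f) u t =
    if k ≤ᵇ t then ∞
    else min∞ (fin 1 +∞ sum∞ (map (λ x → F f x 1) (children u)))
              (sum∞ (map (λ x → F f x (suc t)) (children u)))

  -- the value of the same recursion when the options are fixed by the
  -- decision set X (u ∈ X  ⇔  first option, i.e. shortcut {s,u})
  C : Subset (Graph.N G) → ℕ → Fin (Graph.N G) → ℕ → ℕ∞
  C X zero    u t = ∞
  C X (suc f) u t =
    if k ≤ᵇ t then ∞
    else (if lookup X u then fin 1 +∞ sum∞ (map (λ x → C X f x 1) (children u))
          else sum∞ (map (λ x → C X f x (suc t)) (children u)))

  optValue : ℕ∞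
  optValue = sum∞ (map (λ u → F (Graph.N G) u 0) (children s))

  Realizes : Subset (Graph.N G) → Set
  Realizes X =
    (∀ u → u ∈ X → (u ∈ A) × (u ≢ s)) ×
    (sum∞ (map (λ u → C X (Graph.N G) u 0) (children s)) ≡ optValue)

DPOutput : (G : Graph) → ℕ → ℕ → ShortcutSet (Graph.N G) → Set
DPOutput G k ρ S =
  Σ ((s : Fin (Graph.N G)) → SPTree G ρ s) λ T →
  Σ (Fin (Graph.N G) → Subset (Graph.N G)) λ X →
                ((∀ s → DP.Realizes G k ρ (T s) (X s)) ×
                 (∀ u v → (S u v ≡ true) ⇔ ((v ∈ X u) ⊎ (u ∈ X v))))

module Submission where

open import Defs
open import Data.Nat using (ℕ; _≤_; _*_; _∸_)
open import Data.Product using (Σ; ∃-syntax; _×_)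

open import Data.Nat using (zero; suc; _+_; _⊓_; _<_; _≤ᵇ_; _<ᵇ_; z≤n; s≤s; s≤s⁻¹; z<s; ∣_-_∣)
import Data.Nat as ℕ
open import Data.Nat.Properties hiding (_≟_)
open import Data.Bool using (Bool; true; false; T; T?; _∧_; _∨_; not; if_then_else_)
import Data.Bool as Bool
open import Data.Bool.Properties using (∧-comm; ∨-comm; ∧-zeroʳ)
open import Data.Maybe using (Maybe; just; nothing)
open import Data.Fin using (Fin; toℕ; fromℕ<; _≟_) renaming (zero to fzero; suc to fsuc)
open import Data.Fin.Properties using (toℕ-fromℕ<; toℕ-injective; any?)
import Data.Fin.Properties as Fin
open import Data.Fin.Subset using (Subset; _∈_; _∉_; ∣_∣; ⊤)
open import Data.Fin.Subset.Properties using (∣p∣≤n; ∣⊤∣≡n; ∣p∣≡n⇒p≡⊤; ∈⊤; p⊂q⇒∣p∣<∣q∣; _∈?_)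
open import Data.List using (List; []; _∷_; _++_; filterᵇ; length; map; concatMap; tabulate; allFin)
open import Data.List.Properties using (filter-++; length-++; map-tabulate)
open import Data.List.Relation.Unary.All as All using ()
open import Data.List.Relation.Unary.Any using (here; there)
open import Data.List.Membership.Propositional using () renaming (_∈_ to _∈ₗ_)
open import Data.List.Membership.Propositional.Properties using (∈-allFin; ∈-filter⁺; ∈-filter⁻)
open import Data.List.Extrema ≤-totalOrder using (argmax; f[xs]≤f[argmax])
open import Data.Vec using (lookup)
open import Data.Vec.Properties using (lookup⇒[]=; []=⇒lookup)
open import Data.Product using (_,_; proj₁; proj₂)
open import Data.Sum using (_⊎_; inj₁; inj₂)
open import Data.Empty using (⊥-elim)
open import Function using (_∘_; id)
open import Function.Bundles using (Equivalence)
open import Relation.Nullary using (¬_; Dec; yes; no; does)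
open import Relation.Nullary.Decidable using (dec-true; dec-false; _×-dec_)
open import Relation.Binary.Definitions using (tri<; tri≈; tri>)
open import Relation.Binary.PropositionalEquality
open import Algebra.Properties.Monoid.Sum +-0-monoid using (sum; sum-syntax; sum-cong-≗)

-- The instance is a double broom: n left leaves attached to one end of a path
-- of k vertices and n right leaves attached to its other end, all edges of
-- weight 1, and ρ is the number N = 2n + k of vertices. Then r_ρ(v) is the
-- eccentricity of v, so v has a (k,ρ)-ball iff every vertex is reachable from v
-- by a shortest path of at most k edges. Only left-right pairs are k + 1 hops
-- apart, so the graph itself is not a (k,ρ)-graph while the single shortcut
-- joining the ends of the path makes it one: the optimum is 1. Greedy shortcuts
-- all n² left-right pairs. For a left source s the shortest-path tree runs along
-- the path, whose last vertex has the right leaves as children at depth k + 1,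
-- so every decision set realising the DP optimum shortcuts s to a path vertex;
-- distinct sources give n distinct shortcuts.

<∞-≤∞-trans : ∀ {x y z} → x <∞ y → y ≤∞ z → x <∞ z
<∞-≤∞-trans (fin<fin x<y) (fin≤fin y≤z) = fin<fin (<-≤-trans x<y y≤z)
<∞-≤∞-trans (fin<fin _) any≤∞ = fin<∞
<∞-≤∞-trans fin<∞ any≤∞ = fin<∞

≤∞-<∞-trans : ∀ {x y z} → x ≤∞ y → y <∞ z → x <∞ z
≤∞-<∞-trans (fin≤fin x≤y) (fin<fin y<z) = fin<fin (≤-<-trans x≤y y<z)
≤∞-<∞-trans (fin≤fin _) fin<∞ = fin<∞

<∞-irrefl : ∀ {x} → ¬ (x <∞ x)
<∞-irrefl (fin<fin x<x) = <-irrefl refl x<x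

+∞-finite : ∀ {x y} → x ≢ ∞ → y ≢ ∞ → x +∞ y ≢ ∞
+∞-finite {fin _} {fin _} _ _ ()
+∞-finite {fin _} {∞} _ y≢∞ = y≢∞
+∞-finite {∞} x≢∞ _ = x≢∞

min∞-finite : ∀ {x} y → x ≢ ∞ → min∞ x y ≢ ∞
min∞-finite {fin m} (fin n) _ with m ≤ᵇ n
... | true = λ ()
... | false = λ ()
min∞-finite {fin _} ∞ _ = λ ()
min∞-finite {∞} _ ∞≢∞ = ⊥-elim (∞≢∞ refl)

sum∞-finite : ∀ {A : Set} (g : A → ℕ∞) {xs} → (∀ x → x ∈ₗ xs → g x ≢ ∞) → sum∞ (map g xs) ≢ ∞
sum∞-finite g {[]} _ = λ ()
sum∞-finite g {x ∷ xs} g≢∞ = +∞-finite (g≢∞ x (here refl)) (sum∞-finite g λ y y∈ → g≢∞ y (there y∈))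

sum∞-∞ : ∀ {A : Set} (g : A → ℕ∞) {x xs} → x ∈ₗ xs → g x ≡ ∞ → sum∞ (map g xs) ≡ ∞
sum∞-∞ g (here refl) gx≡∞ rewrite gx≡∞ = refl
sum∞-∞ g {xs = y ∷ _} (there x∈) gx≡∞ rewrite sum∞-∞ g x∈ gx≡∞ with g y
... | fin _ = refl
... | ∞ = refl

≤ᵇ-true : ∀ {m n} → m ≤ n → (m ≤ᵇ n) ≡ true
≤ᵇ-true {m} {n} = dec-true (m ≤? n)

≤ᵇ-false : ∀ {m n} → n < m → (m ≤ᵇ n) ≡ false
≤ᵇ-false {m} {n} n<m = dec-false (m ≤? n) (<⇒≱ n<m)

<ᵇ-true : ∀ {m n} → m < n → (m <ᵇ n) ≡ true
<ᵇ-true {m} {n} = dec-true (m <? n)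

<ᵇ-false : ∀ {m n} → n ≤ m → (m <ᵇ n) ≡ false
<ᵇ-false {m} {n} n≤m = dec-false (m <? n) (≤⇒≯ n≤m)

does-∧ : ∀ {A B : Set} (a? : Dec A) (b? : Dec B) → does a? ∧ does b? ≡ true → A × B
does-∧ (yes a) (yes b) _ = a , b
does-∧ (yes _) (no _) ()
does-∧ (no _) _ ()

module _ {N : ℕ} {E : EdgeRel N} where

  _▷_ : ∀ {u x v W h c} → Walk E u x W h → E x v c → Walk E u v (W + c) (suc h)
  _▷_ {c = c} nil e = subst (λ W → Walk E _ _ W 1) (+-identityʳ c) (cons e nil)
  _▷_ {u} {v = v} {c = c′} (cons {c = c} {W = W} {h = h} e w) e′ =
    subst (λ W′ → Walk E u v W′ (suc (suc h))) (sym (+-assoc c W c′)) (cons e (w ▷ e′))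

  reverse : (∀ {x y c} → E x y c → E y x c) → ∀ {u v W h} → Walk E u v W h → Walk E v u W h
  reverse sym-E nil = nil
  reverse sym-E {u} {v} (cons {c = c} {W = W} {h = h} e w) =
    subst (λ W′ → Walk E v u W′ (suc h)) (+-comm W c) (reverse sym-E w ▷ sym-E e)

  _++ʷ_ : ∀ {u x v W W′ h h′} → Walk E u x W h → Walk E x v W′ h′ → Walk E u v (W + W′) (h + h′)
  nil ++ʷ w′ = w′
  _++ʷ_ {u} {v = v} {W′ = W′} {h′ = h′} (cons {c = c} {W = W} {h = h} e w) w′ =
    subst (λ W″ → Walk E u v W″ (suc (h + h′))) (sym (+-assoc c W W′)) (cons e (w ++ʷ w′))

  ∣-∣-walk≤weight : (f : Fin N → ℕ) → (∀ {x y c} → E x y c → ∣ f x - f y ∣ ≤ c) →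
                    ∀ {u v W h} → Walk E u v W h → ∣ f u - f v ∣ ≤ W
  ∣-∣-walk≤weight f lip {u} nil = ≤-reflexive (∣n-n∣≡0 (f u))
  ∣-∣-walk≤weight f lip {u} {v} (cons {x = x} e w) =
    ≤-trans (∣-∣-triangle (f u) (f x) (f v)) (+-mono-≤ (lip e) (∣-∣-walk≤weight f lip w))

  unit⇒weight≡length : (∀ {x y c} → E x y c → c ≡ 1) → ∀ {u v W h} → Walk E u v W h → W ≡ h
  unit⇒weight≡length unit nil = refl
  unit⇒weight≡length unit (cons e w) = cong₂ _+_ (unit e) (unit⇒weight≡length unit w)

  IsDist-unique : ∀ {u v d D} → IsDist E u v d → IsDist E u v (fin D) → d ≡ fin D
  IsDist-unique {d = fin D′} ((_ , w′) , min′) ((_ , w) , min) = cong fin (≤-antisym (min′ _ _ w) (min _ _ w′))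
  IsDist-unique {d = ∞} unreachable ((_ , w) , _) = ⊥-elim (unreachable _ _ w)

  IsHop-unique : ∀ {u v h′ h} → IsHop E u v (fin h′) → IsHop E u v (fin h) → h′ ≡ h
  IsHop-unique (_ , dist′ , w′ , min′) (_ , dist , w , min) with IsDist-unique dist′ dist
  ... | refl = ≤-antisym (min′ _ w) (min _ w′)

  IsHop-≤ : ∀ {u v D h H} → IsDist E u v (fin D) → Walk E u v D h → IsHop E u v H → H ≤∞ fin h
  IsHop-≤ {H = ∞} _ w unreachable = ⊥-elim (unreachable _ _ w)
  IsHop-≤ {H = fin _} dist w (_ , dist′ , _ , min′) with IsDist-unique dist′ dist
  ... | refl = fin≤fin (min′ _ w)

  IsHop-refl : ∀ {u} → IsHop E u u (fin 0)
  IsHop-refl = 0 , ((0 , nil) , λ _ _ _ → z≤n) , nil , λ _ _ → z≤n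

  IsDist-sym : (∀ {x y c} → E x y c → E y x c) → ∀ {u v D} → IsDist E u v (fin D) → IsDist E v u (fin D)
  IsDist-sym sym-E ((h , w) , min) = (h , reverse sym-E w) , λ W h′ w′ → min W h′ (reverse sym-E w′)

  unit⇒IsHop : (∀ {x y c} → E x y c → c ≡ 1) → ∀ {u v D} → IsDist E u v (fin D) → IsHop E u v (fin D)
  unit⇒IsHop unit dist@((h , w) , _) =
    _ , dist , subst (Walk E _ _ _) (sym (unit⇒weight≡length unit w)) w ,
    λ _ w′ → ≤-reflexive (unit⇒weight≡length unit w′)

GEdge-sym : ∀ G {x y c} → GEdge G x y c → GEdge G y x c
GEdge-sym G {x} {y} e = trans (Graph.w-sym G y x) e

module _ (G : Graph) (S : ShortcutSet (Graph.N G)) where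

  liftWalk : ∀ {u v W h} → Walk (GEdge G) u v W h → Walk (Augment G S) u v W h
  liftWalk nil = nil
  liftWalk (cons e w) = cons (inj₁ e) (liftWalk w)

  flattenWalk : ∀ {u v W h} → Walk (Augment G S) u v W h → ∃[ h′ ] Walk (GEdge G) u v W h′
  flattenWalk nil = 0 , nil
  flattenWalk (cons (inj₁ e) w) = let h′ , w′ = flattenWalk w in suc h′ , cons e w′
  flattenWalk (cons (inj₂ (_ , (_ , detour) , _)) w) = let _ , w′ = flattenWalk w in _ , detour ++ʷ w′

  Augment-sym : (∀ x y → S x y ≡ S y x) → ∀ {x y c} → Augment G S x y c → Augment G S y x c
  Augment-sym _ (inj₁ e) = inj₁ (GEdge-sym G e)
  Augment-sym S-sym {x} {y} (inj₂ (Sxy , dist)) = inj₂ (trans (S-sym y x) Sxy , IsDist-sym (GEdge-sym G) dist)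

  Augment-IsDist : ∀ {u v D} → IsDist (GEdge G) u v (fin D) → IsDist (Augment G S) u v (fin D)
  Augment-IsDist ((h , w) , min) = (h , liftWalk w) , λ W h′ w′ → let _ , w″ = flattenWalk w′ in min W _ w″

n≤∣p∣⇒x∈p : ∀ {N} {A : Subset N} → N ≤ ∣ A ∣ → ∀ x → x ∈ A
n≤∣p∣⇒x∈p {A = A} N≤∣A∣ x = subst (x ∈_) (sym (∣p∣≡n⇒p≡⊤ (≤-antisym (∣p∣≤n A) N≤∣A∣))) ∈⊤

module _ {N : ℕ} {E : EdgeRel N} where

  IsNearest-everything : ∀ {u A} → (∀ v → Reachable E u v) → IsNearest E N u A → ∀ v → v ∈ A
  IsNearest-everything _ (_ , _ , inj₁ ∣A∣≡N , _) = n≤∣p∣⇒x∈p (≤-reflexive (sym ∣A∣≡N))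
  IsNearest-everything reachable (_ , _ , inj₂ all∈A , _) v = all∈A v (reachable v)

module _ {N : ℕ} {E : EdgeRel N} {k : ℕ} where

  -- The radius r_N(v) is attained at the farthest vertex, and r̄_k(v) = ∞.
  bounded-hops⇒HasBall : ∀ {v} (d : Fin N → ℕ) → (∀ y → IsDist E v y (fin (d y))) →
                         (∀ y → ∃[ h ] (h ≤ k × Walk E v y (d y) h)) → HasBall E k N v
  bounded-hops⇒HasBall {v} d dist short =
    fin (d far) , ∞ , (fewer , inj₂ (⊤ , all-within , ≤-reflexive (sym (∣⊤∣≡n N)))) ,
    ((λ x P → ⊥-elim (no-far x P)) , inj₂ (refl , no-far)) , fin<∞
    where
    far : Fin N
    far = argmax d v (allFin N)

    d≤d-far : ∀ y → d y ≤ d far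
    d≤d-far y = All.lookup (f[xs]≤f[argmax] v (allFin N)) (∈-allFin y)

    all-within : ∀ y → y ∈ ⊤ → DistLe E v y (fin (d far))
    all-within y _ = fin (d y) , dist y , fin≤fin (d≤d-far y)

    fewer : ∀ B → (∀ y → y ∈ B → DistLt E v y (fin (d far))) → ∣ B ∣ < N
    fewer B closer = subst (∣ B ∣ <_) (∣⊤∣≡n N) (p⊂q⇒∣p∣<∣q∣ ((λ _ → ∈⊤) , far , ∈⊤ , far∉B))
      where
      far∉B : far ∉ B
      far∉B far∈B with closer far far∈B
      ... | _ , dist′ , lt with IsDist-unique dist′ (dist far)
      ... | refl = <∞-irrefl lt

    no-far : ∀ x → ¬ (∃[ y ] ∃[ H ] (IsHop E v y H × fin k <∞ H × IsDist E v y x))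
    no-far _ (y , H , hop , k<H , _) with short y
    ... | h , h≤k , w with <∞-≤∞-trans k<H (IsHop-≤ (dist y) w hop)
    ... | fin<fin k<h = <⇒≱ k<h h≤k

  -- r_N(v) ≥ d(v,w) ≥ r̄_k(v).
  far-vertex⇒¬HasBall : ∀ {v w h} → IsHop E v w (fin h) → k < h → ¬ HasBall E k N v
  far-vertex⇒¬HasBall _ _ (_ , _ , (_ , inj₁ refl) , _ , ())
  far-vertex⇒¬HasBall {w = w} hop@(D , dist , _) k<h (r , r̄ , (_ , inj₂ (A , within , N≤∣A∣)) , (r̄≤ , _) , r<r̄)
    with within w (n≤∣p∣⇒x∈p N≤∣A∣ w)
  ... | _ , dist′ , D≤r with IsDist-unique dist′ dist
  ... | refl = <∞-irrefl (≤∞-<∞-trans D≤r (<∞-≤∞-trans r<r̄ r̄≤D))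
    where
    r̄≤D : r̄ ≤∞ fin D
    r̄≤D = r̄≤ (fin D) (w , _ , hop , fin<fin k<h , dist)

indicator : Bool → ℕ
indicator b = if b then 1 else 0

length-filterᵇ-tabulate : ∀ {A : Set} {n} (p : A → Bool) (g : Fin n → A) →
                          length (filterᵇ p (tabulate g)) ≡ ∑[ i < n ] indicator (p (g i))
length-filterᵇ-tabulate {n = zero} p g = refl
length-filterᵇ-tabulate {n = suc n} p g with p (g fzero)
... | true = cong suc (length-filterᵇ-tabulate p (g ∘ fsuc))
... | false = length-filterᵇ-tabulate p (g ∘ fsuc)

length-filterᵇ-concatMap : ∀ {A B : Set} {n} (p : B → Bool) (f : A → List B) (g : Fin n → A) →
                           length (filterᵇ p (concatMap f (tabulate g))) ≡ ∑[ i < n ] length (filterᵇ p (f (g i)))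
length-filterᵇ-concatMap {n = zero} p f g = refl
length-filterᵇ-concatMap {n = suc n} p f g = begin
  length (filterᵇ p (f (g fzero) ++ concatMap f (tabulate (g ∘ fsuc))))
    ≡⟨ cong length (filter-++ _ (f (g fzero)) _) ⟩
  length (filterᵇ p (f (g fzero)) ++ filterᵇ p (concatMap f (tabulate (g ∘ fsuc))))
    ≡⟨ length-++ (filterᵇ p (f (g fzero))) ⟩
  length (filterᵇ p (f (g fzero))) + length (filterᵇ p (concatMap f (tabulate (g ∘ fsuc))))
    ≡⟨ cong (length (filterᵇ p (f (g fzero))) +_) (length-filterᵇ-concatMap p f (g ∘ fsuc)) ⟩
  ∑[ i < suc n ] length (filterᵇ p (f (g i))) ∎
  where open ≡-Reasoning

∑-≥-term : ∀ {n} (f : Fin n → ℕ) i → f i ≤ sum f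
∑-≥-term f fzero = m≤m+n (f fzero) _
∑-≥-term f (fsuc i) = ≤-trans (∑-≥-term (f ∘ fsuc) i) (m≤n+m _ (f fzero))

∑-≥-block : ∀ {n} (f : Fin n → ℕ) {c} lo m → lo + m ≤ n →
            (∀ i → lo ≤ toℕ i → toℕ i < lo + m → c ≤ f i) → m * c ≤ sum f
∑-≥-block f zero zero _ _ = z≤n
∑-≥-block {suc n} f zero (suc m) (s≤s m≤n) c≤f =
  +-mono-≤ (c≤f fzero z≤n (s≤s z≤n)) (∑-≥-block (f ∘ fsuc) 0 m m≤n λ i _ i<m → c≤f (fsuc i) z≤n (s≤s i<m))
∑-≥-block {suc n} f (suc lo) m (s≤s lo+m≤n) c≤f =
  ≤-trans (∑-≥-block (f ∘ fsuc) lo m lo+m≤n λ i lo≤i i<lo+m → c≤f (fsuc i) (s≤s lo≤i) (s≤s i<lo+m))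
          (m≤n+m _ (f fzero))

∑-zero : ∀ {n} (f : Fin n → ℕ) → (∀ i → f i ≡ 0) → sum f ≡ 0
∑-zero {zero} f _ = refl
∑-zero {suc n} f f≡0 = cong₂ _+_ (f≡0 fzero) (∑-zero (f ∘ fsuc) (f≡0 ∘ fsuc))

∑-single : ∀ {n} (f : Fin n → ℕ) i → (∀ j → j ≢ i → f j ≡ 0) → sum f ≡ f i
∑-single f fzero f≡0 = trans (cong (f fzero +_) (∑-zero (f ∘ fsuc) λ j → f≡0 (fsuc j) λ ())) (+-identityʳ _)
∑-single f (fsuc i) f≡0 =
  cong₂ _+_ (f≡0 fzero λ ()) (∑-single (f ∘ fsuc) i λ j j≢i → f≡0 (fsuc j) (j≢i ∘ Fin.suc-injective))

pairsFrom : ∀ {N} → ShortcutSet N → Fin N → Fin N → ℕ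
pairsFrom S u v = indicator ((toℕ u <ᵇ toℕ v) ∧ S u v)

card≡∑∑ : ∀ {N} (S : ShortcutSet N) → card S ≡ ∑[ u < N ] ∑[ v < N ] pairsFrom S u v
card≡∑∑ {N} S = trans (length-filterᵇ-concatMap P row id) (sum-cong-≗ λ u →
  trans (cong (length ∘ filterᵇ P) (map-tabulate id (u ,_))) (length-filterᵇ-tabulate P (u ,_)))
  where
  P : Fin N × Fin N → Bool
  P (u , v) = (toℕ u <ᵇ toℕ v) ∧ S u v
  row : Fin N → List (Fin N × Fin N)
  row u = map (u ,_) (allFin N)

pairsFrom-true : ∀ {N} (S : ShortcutSet N) {u v} → S u v ≡ true → toℕ u < toℕ v → pairsFrom S u v ≡ 1
pairsFrom-true S Suv u<v rewrite Suv | <ᵇ-true u<v = refl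

card-≥-pair : ∀ {N} (S : ShortcutSet N) {u v} → S u v ≡ true → toℕ u < toℕ v → 1 ≤ card S
card-≥-pair S {u} {v} Suv u<v = begin
  1                                   ≡⟨ pairsFrom-true S Suv u<v ⟨
  pairsFrom S u v                     ≤⟨ ∑-≥-term (pairsFrom S u) v ⟩
  ∑[ v′ < _ ] pairsFrom S u v′        ≤⟨ ∑-≥-term (λ u′ → ∑[ v′ < _ ] pairsFrom S u′ v′) u ⟩
  ∑[ u′ < _ ] ∑[ v′ < _ ] pairsFrom S u′ v′ ≡⟨ card≡∑∑ S ⟨
  card S                              ∎
  where open ≤-Reasoning

card-≥-rows : ∀ {N} (S : ShortcutSet N) {c} lo m → lo + m ≤ N →
              (∀ u → lo ≤ toℕ u → toℕ u < lo + m → c ≤ ∑[ v < N ] pairsFrom S u v) → m * c ≤ card S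
card-≥-rows S lo m lo+m≤N rows = subst (_ ≤_) (sym (card≡∑∑ S)) (∑-≥-block _ lo m lo+m≤N rows)

pair : ∀ {N} → Fin N → Fin N → ShortcutSet N
pair a b x y = (does (x ≟ a) ∧ does (y ≟ b)) ∨ (does (x ≟ b) ∧ does (y ≟ a))

module _ {N} {a b : Fin N} where

  pair-sym : ∀ x y → pair a b x y ≡ pair a b y x
  pair-sym x y = trans (∨-comm (does (x ≟ a) ∧ does (y ≟ b)) _)
    (cong₂ _∨_ (∧-comm (does (x ≟ b)) _) (∧-comm (does (x ≟ a)) _))

  pair-true : ∀ {x y} → pair a b x y ≡ true → (x ≡ a × y ≡ b) ⊎ (x ≡ b × y ≡ a)
  pair-true {x} {y} eq with does (x ≟ a) ∧ does (y ≟ b) in first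
  ... | true = inj₁ (does-∧ (x ≟ a) (y ≟ b) first)
  ... | false = inj₂ (does-∧ (x ≟ b) (y ≟ a) eq)

  pair-ab : pair a b a b ≡ true
  pair-ab rewrite dec-true (a ≟ a) refl | dec-true (b ≟ b) refl = refl

  card-pair : toℕ a < toℕ b → card (pair a b) ≡ 1
  card-pair a<b = begin
    card (pair a b)                                       ≡⟨ card≡∑∑ (pair a b) ⟩
    ∑[ u < N ] ∑[ v < N ] pairsFrom (pair a b) u v
      ≡⟨ ∑-single _ a (λ u u≢a → ∑-zero (pairsFrom (pair a b) u) λ v → no-pair {u} {v} (u≢a ∘ proj₁)) ⟩
    ∑[ v < N ] pairsFrom (pair a b) a v                   ≡⟨ ∑-single _ b (λ v v≢b → no-pair (v≢b ∘ proj₂)) ⟩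
    pairsFrom (pair a b) a b                              ≡⟨ pairsFrom-true (pair a b) pair-ab a<b ⟩
    1                                                     ∎
    where
    open ≡-Reasoning
    no-pair : ∀ {u v} → ¬ (u ≡ a × v ≡ b) → pairsFrom (pair a b) u v ≡ 0
    no-pair {u} {v} not-ab with pair a b u v in eq
    ... | false = cong indicator (∧-zeroʳ (toℕ u <ᵇ toℕ v))
    ... | true with pair-true eq
    ... | inj₁ ab = ⊥-elim (not-ab ab)
    ... | inj₂ (refl , refl) rewrite <ᵇ-false (<⇒≤ a<b) = refl

module DPProperties (G : Graph) (k ρ : ℕ) {s : Fin (Graph.N G)} (Tₛ : SPTree G ρ s) where
  open SPTree Tₛ
  open DP G k ρ Tₛ

  private
    N = Graph.N G
    isChild : Fin N → Fin N → Bool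
    isChild u x = lookup A x ∧ not (does (x ≟ s)) ∧ does (par x ≟ u)

  ∈-children⁻ : ∀ {x u} → x ∈ₗ children u → x ∈ A × x ≢ s × par x ≡ u
  ∈-children⁻ {x} {u} x∈
    with lookup A x in x∈A | x ≟ s | par x ≟ u | proj₂ (∈-filter⁻ (T? ∘ isChild u) {xs = allFin N} x∈)
  ... | true | no x≢s | yes par≡u | _ = lookup⇒[]= x A x∈A , x≢s , par≡u
  ... | true | no _ | no _ | ()
  ... | true | yes _ | _ | ()
  ... | false | _ | _ | ()

  ∈-children⁺ : ∀ {x u} → x ∈ A → x ≢ s → par x ≡ u → x ∈ₗ children u
  ∈-children⁺ {x} {u} x∈A x≢s par≡u = ∈-filter⁺ (T? ∘ isChild u) (∈-allFin x) isChild-true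
    where
    isChild-true : T (isChild u x)
    isChild-true rewrite []=⇒lookup x∈A | dec-false (x ≟ s) x≢s | dec-true (par x ≟ u) par≡u = _

  par-hop : ∀ {x h} → x ∈ A → x ≢ s → IsHop (GEdge G) s (par x) (fin h) → IsHop (GEdge G) s x (fin (suc h))
  par-hop x∈A x≢s hop with par-ok _ x∈A x≢s
  ... | _ , _ , _ , _ , _ , _ , _ , hop-par , hop-x with IsHop-unique hop-par hop
  ... | refl = hop-x

  child-hop : ∀ {x u h} → x ∈ₗ children u → IsHop (GEdge G) s u (fin h) → IsHop (GEdge G) s x (fin (suc h))
  child-hop x∈ hop with ∈-children⁻ x∈
  ... | x∈A , x≢s , refl = par-hop x∈A x≢s hop

  module _ (1<k : 1 < k) {B : ℕ} (hop≤B : ∀ {x h} → IsHop (GEdge G) s x (fin h) → h ≤ B) where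

    -- Shortcutting every tree node is feasible: it resets the depth to 1 < k.
    F-finite : ∀ f u {t h} → t < k → IsHop (GEdge G) s u (fin h) → B < h + f → F f u t ≢ ∞
    F-finite zero u _ hop B<h+0 = ⊥-elim (<⇒≱ (subst (B <_) (+-identityʳ _) B<h+0) (hop≤B hop))
    F-finite (suc f) u {t} {h} t<k hop B<h+1+f rewrite ≤ᵇ-false t<k =
      min∞-finite _ (+∞-finite {fin 1} (λ ()) (sum∞-finite (λ x → F f x 1) λ x x∈ →
        F-finite f x 1<k (child-hop x∈ hop) (subst (B <_) (+-suc h f) B<h+1+f)))

    optValue-finite : B ≤ N → optValue ≢ ∞
    optValue-finite B≤N = sum∞-finite (λ u → F N u 0) λ u u∈ →
      let u∈A , u≢s , par≡s = ∈-children⁻ u∈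
          hop-u = par-hop u∈A u≢s (subst (λ p → IsHop (GEdge G) s p (fin 0)) (sym par≡s) IsHop-refl)
      in F-finite N u (<-trans z<s 1<k) hop-u (s≤s B≤N)

    Realizes-finite : B ≤ N → ∀ {X u} → Realizes X → u ∈ₗ children s → C X N u 0 ≢ ∞
    Realizes-finite B≤N {X} (_ , sum≡opt) u∈ Cu≡∞ =
      optValue-finite B≤N (trans (sym sum≡opt) (sum∞-∞ (λ u → C X N u 0) u∈ Cu≡∞))

  C-≥k : ∀ X f u {t} → k ≤ t → C X f u t ≡ ∞
  C-≥k X zero u _ = refl
  C-≥k X (suc f) u k≤t rewrite ≤ᵇ-true k≤t = refl

  C-skip-∞ : ∀ X f {u t x} → t < k → u ∉ X → x ∈ₗ children u → C X f x (suc t) ≡ ∞ → C X (suc f) u t ≡ ∞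
  C-skip-∞ X f {u} {t} t<k u∉X x∈ Cx≡∞ rewrite ≤ᵇ-false t<k with lookup X u in u∈X
  ... | true = ⊥-elim (u∉X (lookup⇒[]= u X u∈X))
  ... | false = sum∞-∞ (λ y → C X f y (suc t)) x∈ Cx≡∞

∣n-1+n∣≡1 : ∀ p → ∣ p - suc p ∣ ≡ 1
∣n-1+n∣≡1 zero = refl
∣n-1+n∣≡1 (suc p) = ∣n-1+n∣≡1 p

∣1+n-n∣≡1 : ∀ p → ∣ suc p - p ∣ ≡ 1
∣1+n-n∣≡1 p = trans (∣-∣-comm (suc p) p) (∣n-1+n∣≡1 p)

∣m-n∣≤o : ∀ {m n o} → m ≤ suc o → n ≤ suc o →
          ¬ (m ≡ 0 × n ≡ suc o) → ¬ (m ≡ suc o × n ≡ 0) → ∣ m - n ∣ ≤ o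
∣m-n∣≤o {zero} _ n≤1+o ¬[0,1+o] _ = s≤s⁻¹ (≤∧≢⇒< n≤1+o λ n≡1+o → ¬[0,1+o] (refl , n≡1+o))
∣m-n∣≤o {suc m} {zero} m≤1+o _ _ ¬[1+o,0] = s≤s⁻¹ (≤∧≢⇒< m≤1+o λ m≡1+o → ¬[1+o,0] (m≡1+o , refl))
∣m-n∣≤o {suc m} {suc n} (s≤s m≤o) (s≤s n≤o) _ _ = ≤-trans (∣m-n∣≤m⊔n m n) (⊔-lub m≤o n≤o)

suc[m+n]∸m≡suc[n] : ∀ m n → suc (m + n) ∸ m ≡ suc n
suc[m+n]∸m≡suc[n] m n = trans (cong (_∸ m) (sym (+-suc m n))) (m+n∸m≡n m (suc n))

∣m-1+n∣≡1⇒m≡n : ∀ {m n} → m ≤ n → ∣ m - suc n ∣ ≡ 1 → m ≡ n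
∣m-1+n∣≡1⇒m≡n {zero} {zero} _ _ = refl
∣m-1+n∣≡1⇒m≡n {suc m} {suc n} (s≤s m≤n) gap = cong suc (∣m-1+n∣≡1⇒m≡n m≤n gap)

unitIfOne : ℕ → Maybe ℕ
unitIfOne 1 = just 1
unitIfOne _ = nothing

module DoubleBroom (n′ k′ : ℕ) where

  n k N : ℕ
  n = suc n′
  k = 3 + k′
  N = n + k + n

  -- Vertices 0 … n-1 are the left leaves (layer 0), n … n+k-1 the path
  -- (layers 1 … k) and the last n the right leaves (layer k+1); edges join
  -- vertices of adjacent layers.
  layer : ℕ → ℕ
  layer i = (suc i ∸ n) ⊓ suc k

  layer-mid : ∀ {m} → m ≤ k → layer (n + m) ≡ suc m
  layer-mid {m} m≤k rewrite suc[m+n]∸m≡suc[n] n m = m≤n⇒m⊓n≡m (s≤s m≤k)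

  layer-mid⁻ : ∀ {i m} → layer i ≡ suc m → m < k → i ≡ n + m
  layer-mid⁻ {i} {m} layer≡ m<k with ⊓-sel (suc i ∸ n) (suc k)
  ... | inj₂ ⊓≡k = ⊥-elim (<-irrefl (suc-injective (trans (sym layer≡) ⊓≡k)) m<k)
  ... | inj₁ ⊓≡∸ = suc-injective (begin
    suc i                 ≡⟨ m∸n+n≡m {suc i} {n} (<⇒≤ (m∸n≢0⇒n<m (λ ∸≡0 → 0≢1+n (trans (sym ∸≡0) ∸≡)))) ⟨
    (suc i ∸ n) + n       ≡⟨ cong (_+ n) ∸≡ ⟩
    suc m + n             ≡⟨ cong suc (+-comm m n) ⟩
    suc (n + m)           ∎)
    where
    open ≡-Reasoning
    ∸≡ : suc i ∸ n ≡ suc m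
    ∸≡ = trans (sym ⊓≡∸) layer≡

  pos : Fin N → ℕ
  pos x = layer (toℕ x)

  pos≤ : ∀ x → pos x ≤ suc k
  pos≤ x = m⊓n≤n _ (suc k)

  n+m<N : ∀ {m} → m ≤ k → n + m < N
  n+m<N m≤k = ≤-<-trans (+-monoʳ-≤ n m≤k) (m<m+n (n + k) z<s)

  mid : (m : ℕ) → .(m ≤ k) → Fin N
  mid m m≤k = fromℕ< (n+m<N m≤k)

  toℕ-mid : ∀ {m} .(m≤k : m ≤ k) → toℕ (mid m m≤k) ≡ n + m
  toℕ-mid m≤k = toℕ-fromℕ< (n+m<N m≤k)

  pos-mid : ∀ {m} (m≤k : m ≤ k) → pos (mid m m≤k) ≡ suc m
  pos-mid m≤k = trans (cong layer (toℕ-mid m≤k)) (layer-mid m≤k)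

  left₀ right₀ : Fin N
  left₀ = fromℕ< {0} z<s
  right₀ = mid k ≤-refl

  pos-left : ∀ {x} → toℕ x < n → pos x ≡ 0
  pos-left x<n rewrite m≤n⇒m∸n≡0 x<n = refl

  pos-right : ∀ {x} → n + k ≤ toℕ x → pos x ≡ suc k
  pos-right {x} n+k≤x =
    m≥n⇒m⊓n≡n (subst (_≤ suc (toℕ x) ∸ n) (suc[m+n]∸m≡suc[n] n k) (∸-monoˡ-≤ n (s≤s n+k≤x)))

  pos-left₀ : pos left₀ ≡ 0
  pos-left₀ = pos-left z<s

  pos-right₀ : pos right₀ ≡ suc k
  pos-right₀ = pos-mid ≤-refl

  n≤N : n ≤ N
  n≤N = ≤-trans (m≤m+n n k) (m≤m+n (n + k) n)

  N≤[2+k]*n : N ≤ (2 + k) * n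
  N≤[2+k]*n = begin
    n + k + n        ≡⟨ +-comm (n + k) n ⟩
    n + (n + k)      ≤⟨ +-monoʳ-≤ n (+-monoʳ-≤ n (m≤m*n k n)) ⟩
    n + (n + k * n)  ∎
    where open ≤-Reasoning

  1+k≤N : suc k ≤ N
  1+k≤N = ≤-trans (s≤s (m≤n+m k n′)) (m≤m+n (n + k) n)

  neighbour : ∀ {p} → p ≤ suc k → ∃[ x ] ∣ p - pos x ∣ ≡ 1
  neighbour {p} p≤1+k with p ≤? k
  ... | yes p≤k = mid p p≤k , trans (cong (∣ p -_∣) (pos-mid p≤k)) (∣n-1+n∣≡1 p)
  ... | no p≰k rewrite ≤-antisym p≤1+k (≰⇒> p≰k) =
    mid (2 + k′) k-1≤k , trans (cong (∣ suc k -_∣) (pos-mid k-1≤k)) (∣1+n-n∣≡1 k)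
    where
    k-1≤k : 2 + k′ ≤ k
    k-1≤k = n≤1+n (2 + k′)

  weight : Fin N → Fin N → Maybe ℕ
  weight x y = unitIfOne ∣ pos x - pos y ∣

  weight⁻ : ∀ {x y c} → weight x y ≡ just c → c ≡ 1 × ∣ pos x - pos y ∣ ≡ 1
  weight⁻ {x} {y} w≡c with ∣ pos x - pos y ∣
  weight⁻ refl | 1 = refl , refl
  weight⁻ () | 0
  weight⁻ () | suc (suc _)

  G : Graph
  G = record
    { N = N
    ; w = weight
    ; w-sym = λ x y → cong unitIfOne (∣-∣-comm (pos x) (pos y))
    ; w-loop = λ x → cong unitIfOne (∣n-n∣≡0 (pos x))
    ; w-pos = λ x y c w≡c → ≤-reflexive (sym (proj₁ (weight⁻ w≡c)))
    }

  E : EdgeRel N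
  E = GEdge G

  edge : ∀ {x y} → ∣ pos x - pos y ∣ ≡ 1 → E x y 1
  edge adjacent = cong unitIfOne adjacent

  E-unit : ∀ {x y c} → E x y c → c ≡ 1
  E-unit = proj₁ ∘ weight⁻

  E-lipschitz : ∀ {x y c} → E x y c → ∣ pos x - pos y ∣ ≤ c
  E-lipschitz e = let c≡1 , adjacent = weight⁻ e in ≤-reflexive (trans adjacent (sym c≡1))

  dist : Fin N → Fin N → ℕ
  dist u v with u ≟ v | pos u ℕ.≟ pos v
  ... | yes _ | _ = 0
  ... | no _ | yes _ = 2
  ... | no _ | no _ = ∣ pos u - pos v ∣

  dist-refl : ∀ u → dist u u ≡ 0
  dist-refl u with u ≟ u
  ... | yes _ = refl
  ... | no u≢u = ⊥-elim (u≢u refl)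

  dist-same-layer : ∀ {u v} → u ≢ v → pos u ≡ pos v → dist u v ≡ 2
  dist-same-layer {u} {v} u≢v same with u ≟ v | pos u ℕ.≟ pos v
  ... | yes u≡v | _ = ⊥-elim (u≢v u≡v)
  ... | no _ | yes _ = refl
  ... | no _ | no differ = ⊥-elim (differ same)

  dist-other-layer : ∀ {u v} → pos u ≢ pos v → dist u v ≡ ∣ pos u - pos v ∣
  dist-other-layer {u} {v} differ with u ≟ v | pos u ℕ.≟ pos v
  ... | yes refl | _ = ⊥-elim (differ refl)
  ... | no _ | yes same = ⊥-elim (differ same)
  ... | no _ | no _ = refl

  climb : ∀ d {u v} → d + suc (pos u) ≡ pos v → Walk E u v (suc d) (suc d)
  climb zero {u} eq = cons (edge (trans (cong (∣ pos u -_∣) (sym eq)) (∣n-1+n∣≡1 (pos u)))) nil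
  climb (suc d) {u} {v} eq =
    cons (edge (trans (cong (∣ pos u -_∣) (pos-mid pos[u]≤k)) (∣n-1+n∣≡1 (pos u))))
         (climb d (trans (cong (λ p → d + suc p) (pos-mid pos[u]≤k)) (trans (+-suc d (suc (pos u))) eq)))
    where
    pos[u]≤k : pos u ≤ k
    pos[u]≤k = s≤s⁻¹ (≤-trans (m≤n+m (suc (pos u)) (suc d)) (subst (_≤ suc k) (sym eq) (pos≤ v)))

  ascend : ∀ {u v} → pos u < pos v → Walk E u v ∣ pos u - pos v ∣ ∣ pos u - pos v ∣
  ascend {u} {v} p<q with m≤n⇒∃[o]m+o≡n p<q
  ... | d , eq = subst (λ W → Walk E u v W W) (sym gap) (climb d (trans (+-comm d _) eq))
    where
    gap : ∣ pos u - pos v ∣ ≡ suc d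
    gap = trans (cong (∣ pos u -_∣) (trans (sym eq) (sym (+-suc (pos u) d)))) (∣m-m+n∣≡n (pos u) (suc d))

  detour : ∀ {u v} → pos u ≡ pos v → Walk E u v 2 2
  detour {u} {v} same with neighbour (pos≤ u)
  ... | x , adjacent =
    cons (edge adjacent) (cons (edge (trans (∣-∣-comm (pos x) (pos v)) (subst (λ p → ∣ p - pos x ∣ ≡ 1) same adjacent))) nil)

  pair-placement : ∀ u v → u ≡ v ⊎ (u ≢ v × pos u ≡ pos v) ⊎ pos u ≢ pos v
  pair-placement u v with u ≟ v | pos u ℕ.≟ pos v
  ... | yes u≡v | _ = inj₁ u≡v
  ... | no u≢v | yes same = inj₂ (inj₁ (u≢v , same))
  ... | no _ | no differ = inj₂ (inj₂ differ)

  walk : ∀ u v → Walk E u v (dist u v) (dist u v)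
  walk u v with pair-placement u v
  ... | inj₁ refl = subst (λ d → Walk E u u d d) (sym (dist-refl u)) nil
  ... | inj₂ (inj₁ (u≢v , same)) = subst (λ d → Walk E u v d d) (sym (dist-same-layer u≢v same)) (detour same)
  ... | inj₂ (inj₂ differ) with <-cmp (pos u) (pos v)
  ... | tri≈ _ same _ = ⊥-elim (differ same)
  ... | tri< p<q _ _ = subst (λ d → Walk E u v d d) (sym (dist-other-layer differ)) (ascend p<q)
  ... | tri> _ _ q<p = subst (λ d → Walk E u v d d) (trans (∣-∣-comm (pos v) (pos u)) (sym (dist-other-layer differ)))
                              (reverse (GEdge-sym G) (ascend q<p))

  dist≤weight : ∀ {u v W h} → Walk E u v W h → dist u v ≤ W
  dist≤weight {u} {v} w with pair-placement u v
  ... | inj₁ refl = ≤-trans (≤-reflexive (dist-refl u)) z≤n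
  ... | inj₂ (inj₁ (u≢v , same)) = subst (_≤ _) (sym (dist-same-layer u≢v same)) (two-steps w)
    where
    two-steps : ∀ {W h} → Walk E u v W h → 2 ≤ W
    two-steps nil = ⊥-elim (u≢v refl)
    two-steps (cons e nil) = ⊥-elim (0≢1+n (trans (sym (m≡n⇒∣m-n∣≡0 same)) (proj₂ (weight⁻ e))))
    two-steps (cons e (cons e′ _)) rewrite E-unit e | E-unit e′ = s≤s (s≤s z≤n)
  ... | inj₂ (inj₂ differ) = subst (_≤ _) (sym (dist-other-layer differ)) (∣-∣-walk≤weight pos E-lipschitz w)

  dist-sym : ∀ u v → dist u v ≡ dist v u
  dist-sym u v = ≤-antisym (dist≤weight (reverse (GEdge-sym G) (walk v u))) (dist≤weight (reverse (GEdge-sym G) (walk u v)))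

  ∣pos-pos∣≤dist : ∀ u v → ∣ pos u - pos v ∣ ≤ dist u v
  ∣pos-pos∣≤dist u v = ∣-∣-walk≤weight pos E-lipschitz (walk u v)

  dist≡0⇒≡ : ∀ {u v} → dist u v ≡ 0 → u ≡ v
  dist≡0⇒≡ {u} {v} d≡0 with pair-placement u v
  ... | inj₁ u≡v = u≡v
  ... | inj₂ (inj₁ (u≢v , same)) = ⊥-elim (0≢1+n (trans (sym d≡0) (dist-same-layer u≢v same)))
  ... | inj₂ (inj₂ differ) = ⊥-elim (differ (∣m-n∣≡0⇒m≡n (trans (sym (dist-other-layer differ)) d≡0)))

  IsDist-dist : ∀ u v → IsDist E u v (fin (dist u v))
  IsDist-dist u v = (dist u v , walk u v) , λ _ _ → dist≤weight

  IsHop-dist : ∀ u v → IsHop E u v (fin (dist u v))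
  IsHop-dist u v = unit⇒IsHop E-unit (IsDist-dist u v)

  reachable : ∀ u v → Reachable E u v
  reachable u v = dist u v , dist u v , walk u v

  dist-layers : ∀ {u v p q} → pos u ≡ p → pos v ≡ q → p ≢ q → dist u v ≡ ∣ p - q ∣
  dist-layers pu pv p≢q = trans (dist-other-layer λ same → p≢q (trans (sym pu) (trans same pv))) (cong₂ ∣_-_∣ pu pv)

  dist-across : ∀ {u v} → pos u ≡ 0 → pos v ≡ suc k → dist u v ≡ suc k
  dist-across pu pv = dist-layers pu pv λ ()

  dist≤1+k : ∀ u v → dist u v ≤ suc k
  dist≤1+k u v with pair-placement u v
  ... | inj₁ refl = ≤-trans (≤-reflexive (dist-refl u)) z≤n
  ... | inj₂ (inj₁ (u≢v , same)) = ≤-trans (≤-reflexive (dist-same-layer u≢v same)) (s≤s (s≤s z≤n))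
  ... | inj₂ (inj₂ differ) =
    ≤-trans (≤-reflexive (dist-other-layer differ)) (≤-trans (∣m-n∣≤m⊔n (pos u) (pos v)) (⊔-lub (pos≤ u) (pos≤ v)))

  dist≤k : ∀ {u v} → ¬ (pos u ≡ 0 × pos v ≡ suc k) → ¬ (pos u ≡ suc k × pos v ≡ 0) → dist u v ≤ k
  dist≤k {u} {v} ¬across ¬across′ with pair-placement u v
  ... | inj₁ refl = ≤-trans (≤-reflexive (dist-refl u)) z≤n
  ... | inj₂ (inj₁ (u≢v , same)) = ≤-trans (≤-reflexive (dist-same-layer u≢v same)) (s≤s (s≤s z≤n))
  ... | inj₂ (inj₂ differ) = ≤-trans (≤-reflexive (dist-other-layer differ)) (∣m-n∣≤o (pos≤ u) (pos≤ v) ¬across ¬across′)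

  a b : Fin N
  a = mid 0 z≤n
  b = mid (2 + k′) (n≤1+n _)

  dist-ab : dist a b ≡ 2 + k′
  dist-ab = dist-layers (pos-mid z≤n) (pos-mid (n≤1+n _)) λ ()

  a<b : toℕ a < toℕ b
  a<b = subst₂ _<_ (sym (toℕ-mid z≤n)) (sym (toℕ-mid (n≤1+n (2 + k′)))) (+-monoʳ-< n z<s)

  shortcut : ShortcutSet N
  shortcut = pair a b

  shortcut-valid : ValidShortcuts G shortcut
  shortcut-valid = pair-sym , λ u v uv → valid (pair-true uv)
    where
    far-apart : 1 < dist a b
    far-apart = subst (1 <_) (sym dist-ab) (s≤s (s≤s z≤n))
    valid : ∀ {u v} → (u ≡ a × v ≡ b) ⊎ (u ≡ b × v ≡ a) →
            (u ≢ v) × (∃[ D ] IsDist E u v (fin D)) × (∃[ H ] (IsHop E u v H × fin 1 <∞ H))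
    valid (inj₁ (refl , refl)) = (λ a≡b → <-irrefl (cong toℕ a≡b) a<b) , (_ , IsDist-dist a b) ,
      (_ , IsHop-dist a b , fin<fin far-apart)
    valid (inj₂ (refl , refl)) = (λ b≡a → <-irrefl (cong toℕ (sym b≡a)) a<b) , (_ , IsDist-dist b a) ,
      (_ , IsHop-dist b a , fin<fin (subst (1 <_) (dist-sym a b) far-apart))

  E⁺ : EdgeRel N
  E⁺ = Augment G shortcut

  crossing : ∀ {u v} → pos u ≡ 0 → pos v ≡ suc k → Walk E⁺ u v (suc k) 3
  crossing {u} {v} pu pv =
    subst (λ W → Walk E⁺ u v W 3) (cong (λ d → suc (suc (suc d))) (+-comm k′ 1))
      (cons (inj₁ (edge (cong₂ ∣_-_∣ pu (pos-mid z≤n))))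
      (cons (inj₂ (pair-ab {a = a} {b} , subst (IsDist E a b ∘ fin) dist-ab (IsDist-dist a b)))
      (cons (inj₁ (edge (trans (cong₂ ∣_-_∣ (pos-mid (n≤1+n _)) pv) (∣n-1+n∣≡1 k)))) nil)))

  within-k-hops : ∀ u v → ∃[ h ] (h ≤ k × Walk E⁺ u v (dist u v) h)
  within-k-hops u v with (pos u ℕ.≟ 0) ×-dec (pos v ℕ.≟ suc k) | (pos u ℕ.≟ suc k) ×-dec (pos v ℕ.≟ 0)
  ... | yes (pu , pv) | _ = 3 , s≤s (s≤s (s≤s z≤n)) ,
    subst (λ W → Walk E⁺ u v W 3) (sym (dist-across pu pv)) (crossing pu pv)
  ... | no _ | yes (pu , pv) = 3 , s≤s (s≤s (s≤s z≤n)) ,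
    subst (λ W → Walk E⁺ u v W 3) (trans (sym (dist-across pv pu)) (dist-sym v u))
          (reverse (Augment-sym G shortcut pair-sym) (crossing pv pu))
  ... | no ¬across | no ¬across′ = dist u v , dist≤k ¬across ¬across′ , liftWalk G shortcut (walk u v)

  shortcut-suffices : IsKRGraph E⁺ k N
  shortcut-suffices v = bounded-hops⇒HasBall (dist v) (λ y → Augment-IsDist G shortcut (IsDist-dist v y)) (within-k-hops v)

  shortcuts-needed : ∀ S → ValidShortcuts G S → IsKRGraph (Augment G S) k N → 1 ≤ card S
  shortcuts-needed S (S-sym , S-valid) _ with any? (λ u → any? (λ v → S u v Bool.≟ true))
  ... | yes (u , v , Suv) with <-cmp (toℕ u) (toℕ v)
  ... | tri< u<v _ _ = card-≥-pair S Suv u<v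
  ... | tri≈ _ u≡v _ = ⊥-elim (proj₁ (S-valid u v Suv) (toℕ-injective u≡v))
  ... | tri> _ _ v<u = card-≥-pair S (trans (S-sym v u) Suv) v<u
  shortcuts-needed S _ balls | no none = ⊥-elim (far-vertex⇒¬HasBall far ≤-refl (balls left₀))
    where
    unit : ∀ {x y c} → Augment G S x y c → c ≡ 1
    unit (inj₁ e) = E-unit e
    unit {x} {y} (inj₂ (Sxy , _)) = ⊥-elim (none (x , y , Sxy))
    far : IsHop (Augment G S) left₀ right₀ (fin (suc k))
    far = subst (IsHop (Augment G S) left₀ right₀ ∘ fin) (dist-across pos-left₀ pos-right₀)
                (unit⇒IsHop unit (Augment-IsDist G S (IsDist-dist left₀ right₀)))

  optimum : IsOpt G k N 1
  optimum = (shortcut , shortcut-valid , shortcut-suffices , card-pair a<b) , shortcuts-needed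

  greedy-lower-bound : ∀ S → GreedyOutput G k N S → n * n ≤ card S
  greedy-lower-bound S (A , nearest , picks) = card-≥-rows S 0 n (m≤n+m n (n + k)) row≥n
    where
    picked : ∀ {u v} → toℕ u < n → n + k ≤ toℕ v → S u v ≡ true
    picked {u} {v} u<n n+k≤v = Equivalence.from (picks u v)
      (inj₁ (IsNearest-everything (reachable u) (nearest u) v , fin (dist u v) , IsHop-dist u v ,
             fin<fin (subst (k <_) (sym (dist-across (pos-left u<n) (pos-right n+k≤v))) ≤-refl)))
    row≥n : ∀ u → 0 ≤ toℕ u → toℕ u < n → n ≤ sum (pairsFrom S u)
    row≥n u _ u<n = subst (_≤ sum (pairsFrom S u)) (*-identityʳ n) (∑-≥-block (pairsFrom S u) (n + k) n ≤-refl
      λ v n+k≤v _ → ≤-reflexive (sym (pairsFrom-true S (picked u<n n+k≤v) (<-≤-trans u<n (≤-trans (m≤m+n n k) n+k≤v)))))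

  module _ {s : Fin N} (s-left : toℕ s < n) (Tₛ : SPTree G N s) where
    open SPTree Tₛ
    open DP G k N Tₛ
    open DPProperties G k N Tₛ

    everything : ∀ x → x ∈ A
    everything = IsNearest-everything (reachable s) nearest

    hop≤1+k : ∀ {x h} → IsHop E s x (fin h) → h ≤ suc k
    hop≤1+k {x} hop = subst (_≤ suc k) (IsHop-unique (IsHop-dist s x) hop) (dist≤1+k s x)

    parent : ∀ v → v ≢ s → ∣ pos (par v) - pos v ∣ ≡ 1 × suc (dist s (par v)) ≡ dist s v
    parent v v≢s with par-ok v (everything v) v≢s
    ... | _ , _ , _ , _ , w≡c , _ , _ , hop-par , hop-v =
      proj₂ (weight⁻ w≡c) ,
      trans (cong suc (IsHop-unique (IsHop-dist s (par v)) hop-par)) (sym (IsHop-unique (IsHop-dist s v) hop-v))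

    pos≤dist : ∀ v → pos v ≤ dist s v
    pos≤dist v = subst (_≤ dist s v) (cong (∣_- pos v ∣) (pos-left s-left)) (∣pos-pos∣≤dist s v)

    dist-mid : ∀ {m} (m≤k : m ≤ k) → dist s (mid m m≤k) ≡ suc m
    dist-mid m≤k = dist-layers (pos-left s-left) (pos-mid m≤k) λ ()

    mid≢s : ∀ {m} (m≤k : m ≤ k) → mid m m≤k ≢ s
    mid≢s {m} m≤k mid≡s = <⇒≱ s-left (subst (n ≤_) (trans (sym (toℕ-mid m≤k)) (cong toℕ mid≡s)) (m≤m+n n m))

    first-child : mid 0 z≤n ∈ₗ children s
    first-child = ∈-children⁺ (everything _) (mid≢s z≤n) (sym (dist≡0⇒≡ (suc-injective dist≡1)))
      where
      dist≡1 : suc (dist s (par (mid 0 z≤n))) ≡ 1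
      dist≡1 = trans (proj₂ (parent _ (mid≢s z≤n))) (dist-mid z≤n)

    next-child : ∀ {m} (m<k : m < k) → mid (suc m) m<k ∈ₗ children (mid m (<⇒≤ m<k))
    next-child {m} m<k =
      ∈-children⁺ (everything _) (mid≢s m<k) (toℕ-injective (trans (layer-mid⁻ pos-par m<k) (sym (toℕ-mid (<⇒≤ m<k)))))
      where
      v : Fin N
      v = mid (suc m) m<k
      adjacent : ∣ pos (par v) - pos v ∣ ≡ 1
      adjacent = proj₁ (parent v (mid≢s m<k))
      dist-par : dist s (par v) ≡ suc m
      dist-par = suc-injective (trans (proj₂ (parent v (mid≢s m<k))) (dist-mid m<k))
      pos-par : pos (par v) ≡ suc m
      pos-par = ∣m-1+n∣≡1⇒m≡n (subst (pos (par v) ≤_) dist-par (pos≤dist (par v)))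
                              (subst (λ p → ∣ pos (par v) - p ∣ ≡ 1) (pos-mid m<k) adjacent)

    module _ (X : Subset N) where

      -- Unless some mid j is chosen, the chain of children mid m, mid (suc m), …
      -- reaches the right leaves at depth k, where C is ∞.
      blocked-or-hit : ∀ f {m} (m<k : m < k) →
                       C X f (mid m (<⇒≤ m<k)) m ≡ ∞ ⊎ ∃[ j ] Σ (j < k) λ j<k → mid j (<⇒≤ j<k) ∈ X
      blocked-or-hit zero _ = inj₁ refl
      blocked-or-hit (suc f) {m} m<k with mid m (<⇒≤ m<k) ∈? X
      ... | yes hit = inj₂ (m , m<k , hit)
      ... | no miss with suc m <? k
      ... | no 1+m≮k = inj₁ (C-skip-∞ X f m<k miss (next-child m<k) (C-≥k X f _ (≮⇒≥ 1+m≮k)))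
      ... | yes 1+m<k with blocked-or-hit f 1+m<k
      ... | inj₁ blocked = inj₁ (C-skip-∞ X f m<k miss (next-child m<k) blocked)
      ... | inj₂ hit = inj₂ hit

      Realizes⇒hit : Realizes X → ∃[ j ] Σ (j < k) λ j<k → mid j (<⇒≤ j<k) ∈ X
      Realizes⇒hit realizes with blocked-or-hit N z<s
      ... | inj₁ blocked = ⊥-elim (Realizes-finite (s≤s (s≤s z≤n)) hop≤1+k 1+k≤N realizes first-child blocked)
      ... | inj₂ hit = hit

  dp-lower-bound : ∀ S → DPOutput G k N S → n ≤ card S
  dp-lower-bound S (T , X , realizes , chosen) =
    subst (_≤ card S) (*-identityʳ n) (card-≥-rows S 0 n (m≤n+m n (n + k)) row≥1)
    where
    row≥1 : ∀ u → 0 ≤ toℕ u → toℕ u < n → 1 ≤ sum (pairsFrom S u)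
    row≥1 u _ u<n with Realizes⇒hit u<n (T u) (X u) (realizes u)
    ... | j , j<k , j∈X = ≤-trans (≤-reflexive (sym (pairsFrom-true S S-uv u<v))) (∑-≥-term (pairsFrom S u) v)
      where
      v : Fin N
      v = mid j (<⇒≤ j<k)
      S-uv : S u v ≡ true
      S-uv = Equivalence.from (chosen u v) (inj₁ j∈X)
      u<v : toℕ u < toℕ v
      u<v = <-≤-trans u<n (subst (n ≤_) (sym (toℕ-mid (<⇒≤ j<k))) (m≤m+n n j))

theorem13 : ∀ (k : ℕ) → 3 ≤ k →
    Σ (ℕ → ℕ) λ ρ → ∃[ a ] ∃[ b ] ∃[ c ] ∃[ n₀ ] (∀ (n : ℕ) → n₀ ≤ n →
      ∃[ G ] ∃[ opt ]
        ((n ≤ a * Graph.N G) × (Graph.N G ≤ b * n) ×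
         IsOpt G k (ρ n) opt × (1 ≤ opt) ×
         (∀ S → DPOutput G k (ρ n) S → (n ∸ 1) * opt ≤ card S) ×
         (∀ S → GreedyOutput G k (ρ n) S → n * n * opt ≤ c * card S)))
theorem13 zero ()
theorem13 (suc zero) (s≤s ())
theorem13 (suc (suc zero)) (s≤s (s≤s ()))
theorem13 (suc (suc (suc k′))) _ = (λ n → n + (3 + k′) + n) , 1 , 5 + k′ , 1 , 1 , λ where
  zero ()
  (suc n′) _ → let open DoubleBroom n′ k′ in
    G , 1 , subst (n ≤_) (sym (*-identityˡ N)) n≤N , N≤[2+k]*n , optimum , ≤-refl ,
    (λ S dp → ≤-trans (≤-reflexive (*-identityʳ n′)) (≤-trans (n≤1+n n′) (dp-lower-bound S dp))) ,
    (λ S greedy → subst₂ _≤_ (sym (*-identityʳ (n * n))) (sym (*-identityˡ (card S))) (greedy-lower-bound S greedy))
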